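{- Let $p\geq 3$ be an odd integer and let $\tau$ be the permutation of $\{0,1,\dots,p-2\}$ defined by $\tau(j)\equiv 2j+1\pmod p$. Consider the linear system over $\mathbb{F}_2$ in the unknowns $\delta(0),\dots,\delta(p-2)\in\mathbb{F}_2$: \[\delta(j)+\delta(\tau(j))=1,\qquad j=0,1,\dots,p-2.\] (1) The system has no solution if and only if there is a cycle of odd length in the cycle decomposition of $\tau$. (2) The system has exactly $2^k$ solutions if and only if $\tau$ decomposes into $k$ cycles, all of even length (and no cycles of odd length).
   Context: Cycles of length $1$ count as cycles of odd length. -}

module Defs where

open import Data.Nat using (ℕ; suc; _*_)
open import Data.Bool using (Bool; true; _xor_)
open import Data.Fin using (Fin)
open import Data.Vec using (Vec; lookup; tabulate; replicate)
open import Data.List using (List; []; _∷_; length; concat; allFin)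
open import Data.List.Relation.Binary.Permutation.Propositional using (_↭_)
open import Data.Product using (∃-syntax; _×_)
open import Data.Empty using (⊥)
open import Relation.Binary.PropositionalEquality using (_≡_)

Odd : ℕ → Set
Odd n = ∃[ r ] n ≡ suc (2 * r)

Even : ℕ → Set
Even n = ∃[ r ] n ≡ 2 * r

-- The linear system over F₂ (Bool with xor as addition, true = 1):
--   δ(j) + δ(τ(j)) = 1   for all j
IsSolution : {m : ℕ} → (Fin m → Fin m) → Vec Bool m → Set
IsSolution {m} τ δ = tabulate (λ j → lookup δ j xor lookup δ (τ j)) ≡ replicate m true

Chain : {m : ℕ} → (Fin m → Fin m) → Fin m → List (Fin m) → Fin m → Set
Chain f cur []       start = f cur ≡ start
Chain f cur (y ∷ ys) start = (f cur ≡ y) × Chain f y ys start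

-- A list [x₀, …, x_{l-1}] (l ≥ 1) is a cycle of f: f xᵢ = x_{i+1}, f x_{l-1} = x₀.
IsCycle : {m : ℕ} → (Fin m → Fin m) → List (Fin m) → Set
IsCycle f []       = ⊥
IsCycle f (x ∷ xs) = Chain f x xs x

-- A cycle decomposition of f: a list of cycles of f such that every element of
-- Fin m occurs in exactly one cycle, exactly once (the concatenation is a
-- permutation of the list of all elements).
data AllCycles {m : ℕ} (f : Fin m → Fin m) : List (List (Fin m)) → Set where
  []  : AllCycles f []
  _∷_ : ∀ {c cs} → IsCycle f c → AllCycles f cs → AllCycles f (c ∷ cs)

IsCycleDecomposition : {m : ℕ} → (Fin m → Fin m) → List (List (Fin m)) → Set
IsCycleDecomposition {m} f cs = AllCycles f cs × (concat cs ↭ allFin m)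

module Submission where

-- The system δ(j) + δ(τ j) = 1 over 𝔽₂ says exactly that δ alternates along
-- τ: δ(τ j) = ¬ δ(j).

open import Defs
open import Data.Nat using (ℕ; zero; suc; _≤_; _<_; _∸_; _*_; _+_; _^_; _%_; NonZero; z≤n; z<s; s<s; _<?_)
open import Data.Nat.Properties
  using (+-identityʳ; *-suc; m∸n+n≡m; m+[n∸m]≡n; +-suc; +-cancelʳ-<; *-cancelˡ-≡; +-cancelʳ-≡; ≮⇒≥; m<1+n⇒m<n∨m≡n;
         m<n⇒m<1+n; m≤n⇒m≤1+n; n<1+n; <-≤-trans; m∸n≤m; +-mono-≤)
open import Data.Nat.DivMod using ([m+n]%n≡m%n; m<n⇒m%n≡m)
open import Data.Nat.Logarithm using (⌊log₂_⌋; ⌊log₂[2^n]⌋≡n)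
open import Data.Nat.Tactic.RingSolver using (solve-∀)
open import Data.Bool using (Bool; true; false; not; _xor_)
open import Data.Bool.Properties using (not-¬; xor-same; xor-comm; true-xor; xor-identityʳ; not-distribˡ-xor; not-distribʳ-xor)
open import Data.Fin using (Fin; toℕ) renaming (zero to fzero; suc to fsuc)
import Data.Fin.Properties as Fin
open import Data.Vec using (Vec; []; _∷_; lookup; tabulate; replicate; uncons)
open import Data.Vec.Properties using (lookup∘tabulate; lookup-replicate; tabulate-cong; tabulate∘lookup)
open import Data.List using (List; []; _∷_; length; concat; allFin)
open import Data.List.Relation.Unary.All using (All; []; _∷_)
import Data.List.Relation.Unary.All as All
open import Data.List.Relation.Unary.Any using (Any; here; there)
open import Data.List.Relation.Unary.Any.Properties using (concat⁺; concat⁻; concat⁻∘concat⁺)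
open import Data.List.Membership.Propositional using (_∈_; _∉_)
open import Data.List.Membership.Propositional.Properties using (∈-allFin; ∈-++⁻; ∈-++⁺ˡ; ∈-++⁺ʳ)
open import Data.List.Membership.Propositional.Properties.WithK using (unique⇒irrelevant; unique∧set⇒bag)
import Data.List.Membership.DecPropositional as DecMembership
open import Data.List.Relation.Unary.Unique.Propositional using (Unique)
open import Data.List.Relation.Unary.AllPairs using ([]; _∷_)
open import Data.List.Relation.Unary.Unique.Propositional.Properties using (allFin⁺; ++⁺)
open import Data.List.Relation.Binary.Disjoint.Propositional using (Disjoint)
open import Data.List.Relation.Binary.Subset.Propositional using (_⊆_)
open import Data.List.Relation.Binary.Permutation.Propositional using (_↭_; ↭-sym; ↭⇒↭ₛ)
open import Data.List.Relation.Binary.Permutation.Propositional.Properties using (∈-resp-↭)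
import Data.List.Relation.Binary.Permutation.Setoid.Properties as PermSetoid
open import Data.List.Relation.Binary.BagAndSetEquality using (∼bag⇒↭)
open import Data.Product using (Σ; ∃-syntax; _×_; _,_; proj₁; proj₂; uncurry)
open import Data.Product.Function.NonDependent.Propositional using (_×-↔_)
open import Data.Sum using (_⊎_; inj₁; inj₂; [_,_])
open import Data.Empty using (⊥; ⊥-elim)
open import Function.Base using (id)
open import Function.Bundles using (_↔_; _⇔_; mk⇔; mk↔ₛ′; Inverse; Injection)
open import Function.Definitions using (Injective)
open import Function.Properties.Inverse using (↔-trans; ↔-sym; ↔⇒↣)
open import Relation.Nullary using (¬_; Dec; yes; no)
open import Relation.Binary.PropositionalEquality
  using (_≡_; _≢_; refl; sym; trans; cong; cong₂; subst; setoid; module ≡-Reasoning)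
open import Relation.Binary.PropositionalEquality.WithK using (≡-irrelevant)

open ≡-Reasoning

parity : ℕ → Bool
parity zero    = false
parity (suc n) = not (parity n)

parity-+ : ∀ m n → parity (m + n) ≡ parity m xor parity n
parity-+ zero    n = refl
parity-+ (suc m) n = trans (cong not (parity-+ m n)) (not-distribˡ-xor (parity m) (parity n))

parity-double : ∀ r → parity (2 * r) ≡ false
parity-double r = begin
  parity (r + (r + 0))   ≡⟨ cong (λ s → parity (r + s)) (+-identityʳ r) ⟩
  parity (r + r)         ≡⟨ parity-+ r r ⟩
  parity r xor parity r  ≡⟨ xor-same (parity r) ⟩
  false                  ∎

parity-double+1 : ∀ r → parity (2 * r + 1) ≡ true
parity-double+1 r = trans (parity-+ (2 * r) 1) (cong (_xor true) (parity-double r))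

even⇒parity : ∀ {n} → Even n → parity n ≡ false
even⇒parity (r , refl) = parity-double r

odd⇒parity : ∀ {n} → Odd n → parity n ≡ true
odd⇒parity (r , refl) = cong not (parity-double r)

even⊎odd : ∀ n → Even n ⊎ Odd n
even⊎odd zero    = inj₁ (0 , refl)
even⊎odd (suc n) with even⊎odd n
... | inj₁ (r , refl) = inj₂ (r , refl)
... | inj₂ (r , refl) = inj₁ (suc r , sym (*-suc 2 r))

%-below-double : ∀ p .{{_ : NonZero p}} n → n < p + p → n % p ≡ n ⊎ n ≡ n % p + p
%-below-double p n n<2p with n <? p
... | yes n<p = inj₁ (m<n⇒m%n≡m n<p)
... | no n≮p = inj₂ (begin
    n                  ≡⟨ sym (m∸n+n≡m p≤n) ⟩
    n ∸ p + p          ≡⟨ cong (_+ p) (sym n%p≡n∸p) ⟩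
    n % p + p          ∎)
  where
  p≤n : p ≤ n
  p≤n = ≮⇒≥ n≮p
  n∸p<p : n ∸ p < p
  n∸p<p = +-cancelʳ-< p (n ∸ p) p (subst (_< p + p) (sym (m∸n+n≡m p≤n)) n<2p)
  n%p≡n∸p : n % p ≡ n ∸ p
  n%p≡n∸p = begin
    n % p              ≡⟨ cong (_% p) (sym (m∸n+n≡m p≤n)) ⟩
    (n ∸ p + p) % p    ≡⟨ [m+n]%n≡m%n (n ∸ p) p ⟩
    (n ∸ p) % p        ≡⟨ m<n⇒m%n≡m n∸p<p ⟩
    n ∸ p              ∎

double+1<double : ∀ {x p} → x < p → 2 * x + 1 < p + p
double+1<double {x} {p} x<p = subst (_≤ p + p) (identity x) (+-mono-≤ x<p x<p)
  where
  identity : ∀ x → suc x + suc x ≡ suc (2 * x + 1)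
  identity = solve-∀

double+1-cancel : ∀ a b → 2 * a + 1 ≡ 2 * b + 1 → a ≡ b
double+1-cancel a b e = *-cancelˡ-≡ a b 2 (+-cancelʳ-≡ 1 (2 * a) (2 * b) e)

odd≢odd+odd : ∀ {p} → Odd p → ∀ x y → 2 * y + 1 ≢ (2 * x + 1) + p
odd≢odd+odd {p} odd x y e = true≢false (begin
    true                              ≡⟨ sym (parity-double+1 y) ⟩
    parity (2 * y + 1)                ≡⟨ cong parity e ⟩
    parity (2 * x + 1 + p)            ≡⟨ parity-+ (2 * x + 1) p ⟩
    parity (2 * x + 1) xor parity p   ≡⟨ cong₂ _xor_ (parity-double+1 x) (odd⇒parity odd) ⟩
    false                             ∎)
  where
  true≢false : true ≢ false
  true≢false ()

-- For odd p, j ↦ 2j+1 mod p is injective on {0,…,p-1}: two odd numbers below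
-- 2p with the same residue are equal, since they cannot differ by p.
double+1-mod-injective : ∀ p .{{_ : NonZero p}} → Odd p → ∀ {a b} → a < p → b < p →
  (2 * a + 1) % p ≡ (2 * b + 1) % p → a ≡ b
double+1-mod-injective p odd {a} {b} a<p b<p same
  with %-below-double p (2 * a + 1) (double+1<double a<p) | %-below-double p (2 * b + 1) (double+1<double b<p)
... | inj₁ ra | inj₁ rb = double+1-cancel a b (trans (sym ra) (trans same rb))
... | inj₂ ra | inj₂ rb = double+1-cancel a b (trans ra (trans (cong (_+ p) same) (sym rb)))
... | inj₁ ra | inj₂ rb = ⊥-elim (odd≢odd+odd odd a b (trans rb (cong (_+ p) (trans (sym same) ra))))
... | inj₂ ra | inj₁ rb = ⊥-elim (odd≢odd+odd odd b a (trans ra (cong (_+ p) (trans same rb))))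

positionParity : ∀ {A : Set} {x : A} {xs : List A} → x ∈ xs → Bool
positionParity (here _)  = false
positionParity (there q) = not (positionParity q)

module Cycles {m : ℕ} (f : Fin m → Fin m) where

  chain-step : ∀ {cur ys start y} → Chain f cur ys start → (q : y ∈ cur ∷ ys) →
    (Σ (f y ∈ ys) λ r → positionParity r ≡ positionParity q)
    ⊎ (f y ≡ start × positionParity q ≡ parity (length ys))
  chain-step {ys = []}    fcur≡start   (here refl) = inj₂ (fcur≡start , refl)
  chain-step {ys = _ ∷ _} (fcur≡z , _) (here refl) = inj₁ (here fcur≡z , refl)
  chain-step {ys = _ ∷ _} (_ , chain)  (there q) with chain-step chain q
  ... | inj₁ (r , same)  = inj₁ (there r , cong not same)
  ... | inj₂ (fy≡start , last) = inj₂ (fy≡start , cong not last)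

  cycle-closed : ∀ {c y} → IsCycle f c → y ∈ c → f y ∈ c
  cycle-closed {_ ∷ _} cycle q with chain-step cycle q
  ... | inj₁ (r , _)      = there r
  ... | inj₂ (fy≡x , _)   = here fy≡x

  -- On a cycle of even length f always changes the parity of the position,
  -- including the wrap-around from the last element to the head.
  even-cycle-step : ∀ {c y} → IsCycle f c → Even (length c) → (q : y ∈ c) →
    Σ (f y ∈ c) λ r → positionParity r ≡ not (positionParity q)
  even-cycle-step {_ ∷ _} cycle even q with chain-step cycle q
  ... | inj₁ (r , same)      = there r , cong not same
  ... | inj₂ (fy≡x , last)   = here fy≡x , sym (trans (cong not last) (even⇒parity even))

module _ {P : ℕ → Set} (P? : ∀ n → Dec (P n)) where

  least-below : ∀ n → (∀ {j} → j < n → ¬ P j) ⊎ (∃[ k ] P k × (∀ {j} → j < k → ¬ P j))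
  least-below zero = inj₁ λ ()
  least-below (suc n) with least-below n
  ... | inj₂ found = inj₂ found
  ... | inj₁ none with P? n
  ...   | yes pn = inj₂ (n , pn , none)
  ...   | no ¬pn = inj₁ λ j<1+n → [ none , (λ { refl → ¬pn }) ] (m<1+n⇒m<n∨m≡n j<1+n)

  least : ∀ {n} → P n → ∃[ k ] P k × (∀ {j} → j < k → ¬ P j)
  least {n} pn with least-below (suc n)
  ... | inj₁ none  = ⊥-elim (none (n<1+n n) pn)
  ... | inj₂ found = found

module Decomposition {m : ℕ} (f : Fin m → Fin m) (f-injective : Injective _≡_ _≡_ f) where
  open Cycles f
  open DecMembership (Fin._≟_ {m}) using (_∈?_)

  iter : ℕ → Fin m → Fin m
  iter zero    x = x
  iter (suc n) x = f (iter n x)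

  iter-shift : ∀ n y → iter n (f y) ≡ f (iter n y)
  iter-shift zero    y = refl
  iter-shift (suc n) y = cong f (iter-shift n y)

  iter-+ : ∀ a b y → iter (a + b) y ≡ iter a (iter b y)
  iter-+ zero    b y = refl
  iter-+ (suc a) b y = cong f (iter-+ a b y)

  iter-injective : ∀ n {y z} → iter n y ≡ iter n z → y ≡ z
  iter-injective zero    e = e
  iter-injective (suc n) e = iter-injective n (f-injective e)

  -- By pigeonhole among x, f x, …, fᵐ x and injectivity, x returns to itself.
  returns : ∀ x → ∃[ k ] iter (suc k) x ≡ x
  returns x with Fin.pigeonhole (n<1+n m) (λ i → iter (toℕ i) x)
  ... | i , j , i<j , eq = d , iter-injective (toℕ i) (sym (begin
      iter (toℕ i) x                ≡⟨ eq ⟩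
      iter (toℕ j) x                ≡⟨ cong (λ n → iter n x) j≡i+1+d ⟩
      iter (toℕ i + suc d) x        ≡⟨ iter-+ (toℕ i) (suc d) x ⟩
      iter (toℕ i) (iter (suc d) x) ∎))
    where
    d = toℕ j ∸ suc (toℕ i)
    j≡i+1+d : toℕ j ≡ toℕ i + suc d
    j≡i+1+d = sym (trans (+-suc (toℕ i) d) (m+[n∸m]≡n i<j))

  FirstReturn : Fin m → ℕ → Set
  FirstReturn x k = iter (suc k) x ≡ x × (∀ {j} → j < k → iter (suc j) x ≢ x)

  first-return : ∀ x → ∃[ k ] FirstReturn x k
  first-return x = least (λ k → iter (suc k) x Fin.≟ x) {proj₁ (returns x)} (proj₂ (returns x))

  walk : Fin m → ℕ → List (Fin m)
  walk y zero    = []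
  walk y (suc n) = f y ∷ walk (f y) n

  orbit : Fin m → ℕ → List (Fin m)
  orbit x k = x ∷ walk x k

  walk-chain : ∀ n y → Chain f y (walk y n) (iter (suc n) y)
  walk-chain zero    y = refl
  walk-chain (suc n) y = refl , subst (Chain f (f y) (walk (f y) n)) (cong f (iter-shift n y)) (walk-chain n (f y))

  orbit-cycle : ∀ {x k} → iter (suc k) x ≡ x → IsCycle f (orbit x k)
  orbit-cycle {x} {k} ret = subst (Chain f x (walk x k)) ret (walk-chain k x)

  ∈-walk : ∀ n y {z} → z ∈ walk y n → ∃[ i ] i < n × z ≡ iter (suc i) y
  ∈-walk (suc n) y (here refl) = 0 , z<s , refl
  ∈-walk (suc n) y (there q) with ∈-walk n (f y) q
  ... | i , i<n , refl = suc i , s<s i<n , cong f (iter-shift i y)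

  ∈-orbit : ∀ {x k z} → z ∈ orbit x k → ∃[ i ] i ≤ k × z ≡ iter i x
  ∈-orbit (here refl) = 0 , z≤n , refl
  ∈-orbit {x} {k} (there q) with ∈-walk k x q
  ... | i , i<k , z≡ = suc i , i<k , z≡

  orbit-unique : ∀ n y → (∀ {j} → j < n → iter (suc j) y ≢ y) → Unique (orbit y n)
  walk-unique  : ∀ n y → (∀ {j} → j < n → iter (suc j) y ≢ y) → Unique (walk y n)
  orbit-unique n y early = All.tabulate head-fresh ∷ walk-unique n y early
    where
    head-fresh : ∀ {z} → z ∈ walk y n → y ≢ z
    head-fresh q y≡z with ∈-walk n y q
    ... | i , i<n , z≡ = early i<n (sym (trans y≡z z≡))
  walk-unique zero    y _     = []
  walk-unique (suc n) y early = orbit-unique n (f y) λ {j} j<n e →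
    early (m<n⇒m<1+n j<n) (f-injective (trans (sym (cong f (iter-shift j y))) e))

  covered-step : ∀ {cs} → AllCycles f cs → ∀ {y} → y ∈ concat cs → f y ∈ concat cs
  covered-step {c ∷ _} (cycle ∷ cycles) q with ∈-++⁻ c q
  ... | inj₁ y∈c  = ∈-++⁺ˡ (cycle-closed cycle y∈c)
  ... | inj₂ y∈cs = ∈-++⁺ʳ c (covered-step cycles y∈cs)

  covered-iter : ∀ {cs} → AllCycles f cs → ∀ i {y} → y ∈ concat cs → iter i y ∈ concat cs
  covered-iter cycles zero    q = q
  covered-iter cycles (suc i) q = covered-step cycles (covered-iter cycles i q)

  -- The orbit of a point not yet covered meets no covered point: from any
  -- point of the orbit, iterating f leads back to x.
  orbit-fresh : ∀ {cs x k} → AllCycles f cs → iter (suc k) x ≡ x → x ∉ concat cs →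
    Disjoint (orbit x k) (concat cs)
  orbit-fresh {cs} {x} {k} cycles ret x∉ (z∈orbit , z∈cs) with ∈-orbit z∈orbit
  ... | i , i≤k , refl = x∉ (subst (_∈ concat cs) back (covered-iter cycles (suc k ∸ i) z∈cs))
    where
    back : iter (suc k ∸ i) (iter i x) ≡ x
    back = begin
      iter (suc k ∸ i) (iter i x)   ≡⟨ sym (iter-+ (suc k ∸ i) i x) ⟩
      iter (suc k ∸ i + i) x        ≡⟨ cong (λ n → iter n x) (m∸n+n≡m (m≤n⇒m≤1+n i≤k)) ⟩
      iter (suc k) x                ≡⟨ ret ⟩
      x                             ∎

  DisjointCycles : List (List (Fin m)) → Set
  DisjointCycles cs = AllCycles f cs × Unique (concat cs)

  extend : ∀ {cs} → DisjointCycles cs → ∀ x →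
    ∃[ cs′ ] DisjointCycles cs′ × x ∈ concat cs′ × concat cs ⊆ concat cs′
  extend {cs} (cycles , unique) x with x ∈? concat cs
  ... | yes x∈ = cs , (cycles , unique) , x∈ , id
  ... | no x∉ with first-return x
  ...   | k , ret , early =
    orbit x k ∷ cs ,
    (orbit-cycle ret ∷ cycles , ++⁺ (orbit-unique k x early) unique (orbit-fresh cycles ret x∉)) ,
    here refl , ∈-++⁺ʳ (orbit x k)

  cover : ∀ (xs : List (Fin m)) → ∃[ cs ] DisjointCycles cs × xs ⊆ concat cs
  cover []       = [] , ([] , []) , λ ()
  cover (x ∷ xs) with cover xs
  ... | cs , disjoint , covers with extend disjoint x
  ...   | cs′ , disjoint′ , x∈ , grows = cs′ , disjoint′ , λ { (here refl) → x∈ ; (there q) → grows (covers q) }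

  decomposition : ∃[ cs ] IsCycleDecomposition f cs
  decomposition with cover (allFin m)
  ... | cs , (cycles , unique) , covers =
    cs , cycles , ∼bag⇒↭ (unique∧set⇒bag unique (allFin⁺ m) (λ {x} → mk⇔ (λ _ → ∈-allFin x) covers))

Alternating : ∀ {m} → (Fin m → Fin m) → Vec Bool m → Set
Alternating f δ = ∀ j → lookup δ (f j) ≡ not (lookup δ j)

xor≡true⇒ : ∀ a b → a xor b ≡ true → b ≡ not a
xor≡true⇒ false true  _  = refl
xor≡true⇒ true  false _  = refl
xor≡true⇒ false false ()
xor≡true⇒ true  true  ()

xor-true : ∀ a → a xor true ≡ not a
xor-true a = trans (xor-comm a true) (true-xor a)

module _ {m : ℕ} (f : Fin m → Fin m) where

  solution⇒alternating : ∀ {δ} → IsSolution f δ → Alternating f δ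
  solution⇒alternating {δ} solves j = xor≡true⇒ (lookup δ j) (lookup δ (f j)) (begin
    lookup δ j xor lookup δ (f j)                                ≡⟨ sym (lookup∘tabulate row j) ⟩
    lookup (tabulate row) j                                      ≡⟨ cong (λ v → lookup v j) solves ⟩
    lookup (replicate m true) j                                  ≡⟨ lookup-replicate j true ⟩
    true                                                         ∎)
    where
    row = λ j → lookup δ j xor lookup δ (f j)

  alternating⇒solution : ∀ {δ} → Alternating f δ → IsSolution f δ
  alternating⇒solution {δ} alt = begin
    tabulate (λ j → lookup δ j xor lookup δ (f j))   ≡⟨ tabulate-cong row≡ ⟩
    tabulate (lookup (replicate m true))             ≡⟨ tabulate∘lookup (replicate m true) ⟩
    replicate m true                                 ∎
    where
    row≡ : ∀ j → lookup δ j xor lookup δ (f j) ≡ lookup (replicate m true) j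
    row≡ j = begin
      lookup δ j xor lookup δ (f j)       ≡⟨ cong (lookup δ j xor_) (alt j) ⟩
      lookup δ j xor not (lookup δ j)     ≡⟨ sym (not-distribʳ-xor (lookup δ j) (lookup δ j)) ⟩
      not (lookup δ j xor lookup δ j)     ≡⟨ cong not (xor-same (lookup δ j)) ⟩
      true                                ≡⟨ sym (lookup-replicate j true) ⟩
      lookup (replicate m true) j         ∎

  solution-≡ : ∀ {δ δ′} {s : IsSolution f δ} {s′ : IsSolution f δ′} → δ ≡ δ′ →
    _≡_ {A = Σ (Vec Bool m) (IsSolution f)} (δ , s) (δ′ , s′)
  solution-≡ {δ} {s = s} {s′} refl = cong (δ ,_) (≡-irrelevant s s′)

-- Along a chain an alternating δ flips at every step, so its value at a point
-- is the value at the start of the chain shifted by the position parity.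
module Alternation {m : ℕ} {f : Fin m → Fin m} (δ : Vec Bool m) (alt : Alternating f δ) where

  flip-step : ∀ y π → lookup δ (f y) xor π ≡ lookup δ y xor not π
  flip-step y π = begin
    lookup δ (f y) xor π         ≡⟨ cong (_xor π) (alt y) ⟩
    not (lookup δ y) xor π       ≡⟨ sym (not-distribˡ-xor (lookup δ y) π) ⟩
    not (lookup δ y xor π)       ≡⟨ not-distribʳ-xor (lookup δ y) π ⟩
    lookup δ y xor not π         ∎

  chain-value : ∀ {cur ys start y} → Chain f cur ys start → (q : y ∈ cur ∷ ys) →
    lookup δ y ≡ lookup δ cur xor positionParity q
  chain-value _ (here refl) = sym (xor-identityʳ _)
  chain-value {cur} {z ∷ _} (fcur≡z , chain) (there q) = begin
    lookup δ _                                  ≡⟨ chain-value chain q ⟩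
    lookup δ z xor positionParity q             ≡⟨ cong (λ w → lookup δ w xor positionParity q) (sym fcur≡z) ⟩
    lookup δ (f cur) xor positionParity q       ≡⟨ flip-step cur (positionParity q) ⟩
    lookup δ cur xor not (positionParity q)     ∎

  -- Reaching start takes one step more than the length of ys.
  chain-end : ∀ {cur ys start} → Chain f cur ys start →
    lookup δ start ≡ lookup δ cur xor parity (suc (length ys))
  chain-end {cur} {[]} fcur≡start = begin
    lookup δ _                ≡⟨ cong (lookup δ) (sym fcur≡start) ⟩
    lookup δ (f cur)          ≡⟨ alt cur ⟩
    not (lookup δ cur)        ≡⟨ sym (xor-true (lookup δ cur)) ⟩
    lookup δ cur xor true     ∎
  chain-end {cur} {z ∷ zs} (fcur≡z , chain) = begin
    lookup δ _                                          ≡⟨ chain-end chain ⟩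
    lookup δ z xor parity (suc (length zs))             ≡⟨ cong (λ w → lookup δ w xor parity (suc (length zs))) (sym fcur≡z) ⟩
    lookup δ (f cur) xor parity (suc (length zs))       ≡⟨ flip-step cur (parity (suc (length zs))) ⟩
    lookup δ cur xor parity (suc (suc (length zs)))     ∎

  -- Going once around an odd cycle flips the value at the head: impossible.
  odd-cycle-impossible : ∀ {c} → IsCycle f c → Odd (length c) → ⊥
  odd-cycle-impossible {x ∷ xs} cycle odd = not-¬ refl (begin
    lookup δ x                                ≡⟨ chain-end cycle ⟩
    lookup δ x xor parity (suc (length xs))   ≡⟨ cong (lookup δ x xor_) (odd⇒parity odd) ⟩
    lookup δ x xor true                       ≡⟨ xor-true (lookup δ x) ⟩
    not (lookup δ x)                          ∎)

  some-odd-cycle-impossible : ∀ {cs} → AllCycles f cs → Any (λ c → Odd (length c)) cs → ⊥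
  some-odd-cycle-impossible (_∷_ {c} cycle _) (here odd) = odd-cycle-impossible {c} cycle odd
  some-odd-cycle-impossible (_ ∷ cycles)       (there odd) = some-odd-cycle-impossible cycles odd

-- One bit per cycle prescribes a value at every located point: the bit of its
-- cycle, flipped at the odd positions of that cycle.
module CycleBits {m : ℕ} (f : Fin m → Fin m) where
  open Cycles f

  bitValue : ∀ {ds : List (List (Fin m))} {x} → Vec Bool (length ds) → Any (x ∈_) ds → Bool
  bitValue (b ∷ _)  (here q)  = b xor positionParity q
  bitValue (_ ∷ bs) (there p) = bitValue bs p

  headBits : ∀ {ds} → AllCycles f ds → Vec Bool m → Vec Bool (length ds)
  headBits []                        δ = []
  headBits (_∷_ {x ∷ _} _ cycles)    δ = lookup δ x ∷ headBits cycles δ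

  alternating-from-heads : ∀ {ds} (cycles : AllCycles f ds) {δ} → Alternating f δ →
    ∀ {x} (p : Any (x ∈_) ds) → lookup δ x ≡ bitValue (headBits cycles δ) p
  alternating-from-heads (_∷_ {_ ∷ _} cycle _) {δ} alt (here q) = Alternation.chain-value δ alt cycle q
  alternating-from-heads (_∷_ {_ ∷ _} _ cycles) {δ} alt (there p) = alternating-from-heads cycles {δ} alt p

  bitValue-step : ∀ {ds} → AllCycles f ds → All (λ c → Even (length c)) ds →
    (b : Vec Bool (length ds)) → ∀ {y} (p : Any (y ∈_) ds) →
    Σ (Any (f y ∈_) ds) λ p′ → bitValue b p′ ≡ not (bitValue b p)
  bitValue-step (cycle ∷ _) (even ∷ _) (b ∷ _) (here q) with even-cycle-step cycle even q
  ... | r , flipped = here r , trans (cong (b xor_) flipped) (sym (not-distribʳ-xor b (positionParity q)))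
  bitValue-step (_ ∷ cycles) (_ ∷ evens) (_ ∷ bs) (there p) with bitValue-step cycles evens bs p
  ... | p′ , flipped = there p′ , flipped

  headBits-realising : ∀ {ds} (cycles : AllCycles f ds) (b : Vec Bool (length ds)) {δ} →
    (∀ {x} (p : Any (x ∈_) ds) → lookup δ x ≡ bitValue b p) → headBits cycles δ ≡ b
  headBits-realising []                       []       _       = refl
  headBits-realising (_∷_ {_ ∷ _} _ cycles)   (b ∷ bs) realise =
    cong₂ _∷_ (trans (realise (here (here refl))) (xor-identityʳ b)) (headBits-realising cycles bs (λ p → realise (there p)))

module Solutions {m : ℕ} (f : Fin m → Fin m) {cs : List (List (Fin m))}
                 (cycles : AllCycles f cs) (perm : concat cs ↭ allFin m) where
  open CycleBits f

  locate : ∀ x → Any (x ∈_) cs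
  locate x = concat⁻ cs (∈-resp-↭ (↭-sym perm) (∈-allFin x))

  location-unique : ∀ {x} (p q : Any (x ∈_) cs) → p ≡ q
  location-unique p q = begin
    p                        ≡⟨ sym (concat⁻∘concat⁺ p) ⟩
    concat⁻ cs (concat⁺ p)   ≡⟨ cong (concat⁻ cs) (unique⇒irrelevant covered-unique (concat⁺ p) (concat⁺ q)) ⟩
    concat⁻ cs (concat⁺ q)   ≡⟨ concat⁻∘concat⁺ q ⟩
    q                        ∎
    where
    covered-unique : Unique (concat cs)
    covered-unique = PermSetoid.Unique-resp-↭ (setoid (Fin m)) (↭⇒↭ₛ (↭-sym perm)) (allFin⁺ m)

  fromBits : Vec Bool (length cs) → Vec Bool m
  fromBits b = tabulate (λ x → bitValue b (locate x))

  fromBits-value : ∀ b {x} (p : Any (x ∈_) cs) → lookup (fromBits b) x ≡ bitValue b p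
  fromBits-value b {x} p = trans (lookup∘tabulate (λ x → bitValue b (locate x)) x) (cong (bitValue b) (location-unique (locate x) p))

  module _ (evens : All (λ c → Even (length c)) cs) where

    fromBits-alternating : ∀ b → Alternating f (fromBits b)
    fromBits-alternating b j with bitValue-step cycles evens b (locate j)
    ... | p′ , flipped = trans (fromBits-value b p′) (trans flipped (cong not (sym (fromBits-value b (locate j)))))

    solutions↔bits : Σ (Vec Bool m) (IsSolution f) ↔ Vec Bool (length cs)
    solutions↔bits = mk↔ₛ′ (λ (δ , _) → headBits cycles δ)
      (λ b → fromBits b , alternating⇒solution f {fromBits b} (fromBits-alternating b))
      (λ b → headBits-realising cycles b (fromBits-value b))
      (λ (δ , s) → solution-≡ f (reconstruct (solution⇒alternating f {δ} s)))
      where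
      reconstruct : ∀ {δ} → Alternating f δ → fromBits (headBits cycles δ) ≡ δ
      reconstruct {δ} alt = begin
        fromBits (headBits cycles δ)   ≡⟨ tabulate-cong (λ x → sym (alternating-from-heads cycles {δ} alt (locate x))) ⟩
        tabulate (lookup δ)            ≡⟨ tabulate∘lookup δ ⟩
        δ                              ∎

Vec-Bool↔Fin : ∀ n → Vec Bool n ↔ Fin (2 ^ n)
Vec-Bool↔Fin zero    = mk↔ₛ′ (λ _ → fzero) (λ _ → []) (λ { fzero → refl ; (fsuc ()) }) (λ { [] → refl })
Vec-Bool↔Fin (suc n) = ↔-trans uncons↔ (↔-trans (↔-sym Fin.2↔Bool ×-↔ Vec-Bool↔Fin n) (↔-sym Fin.*↔×))
  where
  uncons↔ : Vec Bool (suc n) ↔ (Bool × Vec Bool n)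
  uncons↔ = mk↔ₛ′ uncons (uncurry _∷_) (λ _ → refl) (λ { (_ ∷ _) → refl })

Fin-↔⇒≡ : ∀ {a b} → Fin a ↔ Fin b → a ≡ b
Fin-↔⇒≡ iso = Fin.cantor-schröder-bernstein (Injection.injective (↔⇒↣ iso)) (Injection.injective (↔⇒↣ (↔-sym iso)))

2^-injective : ∀ {a b} → 2 ^ a ≡ 2 ^ b → a ≡ b
2^-injective {a} {b} e = trans (sym (⌊log₂[2^n]⌋≡n a)) (trans (cong ⌊log₂_⌋ e) (⌊log₂[2^n]⌋≡n b))

all-even⊎some-odd : ∀ {A : Set} (cs : List (List A)) →
  All (λ c → Even (length c)) cs ⊎ Any (λ c → Odd (length c)) cs
all-even⊎some-odd []       = inj₁ []
all-even⊎some-odd (c ∷ cs) with even⊎odd (length c) | all-even⊎some-odd cs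
... | inj₂ odd  | _          = inj₂ (here odd)
... | inj₁ _    | inj₂ odd   = inj₂ (there odd)
... | inj₁ even | inj₁ evens = inj₁ (even ∷ evens)

module Criterion {m : ℕ} (f : Fin m → Fin m) (f-injective : Injective _≡_ _≡_ f) where

  Solution : Set
  Solution = Σ (Vec Bool m) (IsSolution f)

  AllEven SomeOdd : List (List (Fin m)) → Set
  AllEven cs = All (λ c → Even (length c)) cs
  SomeOdd cs = Any (λ c → Odd (length c)) cs

  unsolvable : ∀ {cs} → IsCycleDecomposition f cs → SomeOdd cs → ¬ Solution
  unsolvable (cycles , _) odd (δ , s) =
    Alternation.some-odd-cycle-impossible δ (solution⇒alternating f {δ} s) cycles odd

  count : ∀ {cs} → IsCycleDecomposition f cs → AllEven cs → Solution ↔ Fin (2 ^ length cs)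
  count (cycles , perm) evens = ↔-trans (Solutions.solutions↔bits f cycles perm evens) (Vec-Bool↔Fin _)

  some-element : ∀ k → Fin (2 ^ k)
  some-element k = Inverse.to (Vec-Bool↔Fin k) (replicate k false)

  even-or-odd-decomposition :
    (∃[ cs ] IsCycleDecomposition f cs × AllEven cs) ⊎ (∃[ cs ] IsCycleDecomposition f cs × SomeOdd cs)
  even-or-odd-decomposition with Decomposition.decomposition f f-injective
  ... | cs , decomposed with all-even⊎some-odd cs
  ...   | inj₁ evens = inj₁ (cs , decomposed , evens)
  ...   | inj₂ odd   = inj₂ (cs , decomposed , odd)

  unsolvable⇔odd-cycle : (¬ Solution) ⇔ (∃[ cs ] IsCycleDecomposition f cs × SomeOdd cs)
  unsolvable⇔odd-cycle = mk⇔ odd-cycle (λ (_ , decomposed , odd) → unsolvable decomposed odd)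
    where
    odd-cycle : ¬ Solution → ∃[ cs ] IsCycleDecomposition f cs × SomeOdd cs
    odd-cycle none with even-or-odd-decomposition
    ... | inj₁ (cs , decomposed , evens) = ⊥-elim (none (Inverse.from (count decomposed evens) (some-element (length cs))))
    ... | inj₂ found                     = found

  2^k-solutions⇔k-even-cycles : ∀ k → (Solution ↔ Fin (2 ^ k))
    ⇔ (∃[ cs ] IsCycleDecomposition f cs × length cs ≡ k × AllEven cs)
  2^k-solutions⇔k-even-cycles k = mk⇔ even-cycles (λ { (_ , decomposed , refl , evens) → count decomposed evens })
    where
    even-cycles : Solution ↔ Fin (2 ^ k) → ∃[ cs ] IsCycleDecomposition f cs × length cs ≡ k × AllEven cs
    even-cycles iso with even-or-odd-decomposition
    ... | inj₁ (cs , decomposed , evens) =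
          cs , decomposed , 2^-injective (Fin-↔⇒≡ (↔-trans (↔-sym (count decomposed evens)) iso)) , evens
    ... | inj₂ (_ , decomposed , odd) = ⊥-elim (unsolvable decomposed odd (Inverse.from iso (some-element k)))

proposition5p4 : (p : ℕ) → .{{_ : NonZero p}} → 3 ≤ p → Odd p →
    (τ : Fin (p ∸ 1) → Fin (p ∸ 1)) →
    (∀ j → toℕ (τ j) ≡ (2 * toℕ j + 1) % p) →
    ((¬ Σ (Vec Bool (p ∸ 1)) (IsSolution τ))
    ⇔ (∃[ cs ] IsCycleDecomposition τ cs × Any (λ c → Odd (length c)) cs))
    × (∀ (k : ℕ) →
    (Σ (Vec Bool (p ∸ 1)) (IsSolution τ) ↔ Fin (2 ^ k))
    ⇔ (∃[ cs ] IsCycleDecomposition τ cs × length cs ≡ k × All (λ c → Even (length c)) cs))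
proposition5p4 p _ odd τ τ-def = unsolvable⇔odd-cycle , 2^k-solutions⇔k-even-cycles
  where
  τ-injective : Injective _≡_ _≡_ τ
  τ-injective {a} {b} τa≡τb = Fin.toℕ-injective (double+1-mod-injective p odd (below a) (below b) (begin
    (2 * toℕ a + 1) % p   ≡⟨ sym (τ-def a) ⟩
    toℕ (τ a)             ≡⟨ cong toℕ τa≡τb ⟩
    toℕ (τ b)             ≡⟨ τ-def b ⟩
    (2 * toℕ b + 1) % p   ∎))
    where
    below : ∀ (j : Fin (p ∸ 1)) → toℕ j < p
    below j = <-≤-trans (Fin.toℕ<n j) (m∸n≤m p 1)

  open Criterion τ τ-injective
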